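{- Let $N \ge 2$ and let $A_1,\dots,A_N$ be distinct boolean variables. Define $D_N = (A_N<1)$ and, for $k=N-1,\dots,1$, $D_k = (A_k < D_{k+1})$. Then the disjunction $A_1\vee A_2\vee\dots\vee A_N$ has a minimal $(<,1)$-representation with exactly 2 occurrences of the constant $1$ and exactly one occurrence of each input variable, given by $$A_1\vee A_2\vee \dots \vee A_N = D_1 < 1 = (A_1 < (A_2 < \dots (A_N < 1)\dots)) < 1.$$ Here minimal means that no $(<,1)$-expression computing $A_1\vee\dots\vee A_N$ uses fewer occurrences of the operation $<$.
   Context: Strict Boolean Inequality is the binary boolean operation with $A<B=1$ iff $A=0$ and $B=1$. A $(<,1)$-representation (or $(<,1)$-expression) of a boolean function is an expression built from input variables and the constant $1$ using only the binary operation $<$ (variables and constants may occur several times); its cost is the number of occurrences of $<$ (the constant $1$ has zero cost). -}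

module Defs where

open import Data.Nat using (ℕ; zero; suc; _+_)
open import Data.Bool using (Bool; true; false; _∨_)
open import Data.Fin using (Fin)
open import Data.Fin.Properties using (_≟_)
open import Data.List using (List; []; _∷_; allFin; foldr)
open import Relation.Nullary.Decidable using (does)
open import Relation.Binary.PropositionalEquality using (_≡_)

_<ᵇ_ : Bool → Bool → Bool
false <ᵇ true = true
_     <ᵇ _    = false

data Expr (n : ℕ) : Set where
  var : Fin n → Expr n
  one : Expr n
  _⟨<⟩_ : Expr n → Expr n → Expr n

eval : ∀ {n} → Expr n → (Fin n → Bool) → Bool
eval (var i) ρ = ρ i
eval one ρ = true
eval (e ⟨<⟩ f) ρ = eval e ρ <ᵇ eval f ρ

cost : ∀ {n} → Expr n → ℕ
cost (var i) = 0
cost one = 0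
cost (e ⟨<⟩ f) = suc (cost e + cost f)

ones : ∀ {n} → Expr n → ℕ
ones (var i) = 0
ones one = 1
ones (e ⟨<⟩ f) = ones e + ones f

occ : ∀ {n} → Fin n → Expr n → ℕ
occ i (var j) = if′ (does (i ≟ j))
  where
  if′ : Bool → ℕ
  if′ true = 1
  if′ false = 0
occ i one = 0
occ i (e ⟨<⟩ f) = occ i e + occ i f

disj : ∀ {n} → (Fin n → Bool) → Bool
disj {n} ρ = foldr (λ i b → ρ i ∨ b) false (allFin n)

chain : ∀ {n} → List (Fin n) → Expr n
chain [] = one
chain (i ∷ is) = var i ⟨<⟩ chain is

D₁ : (n : ℕ) → Expr n
D₁ n = chain (allFin n)

orRep : (n : ℕ) → Expr n
orRep n = D₁ n ⟨<⟩ one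

Computes : ∀ {n} → Expr n → ((Fin n → Bool) → Bool) → Set
Computes e g = ∀ ρ → eval e ρ ≡ g ρ

-- The chain D₁ evaluates to ¬(A₁ ∨ … ∨ A_N), so D₁ < 1 computes the disjunction with N + 1
-- occurrences of <.  For the lower bound, compare the values of an expression at the zero
-- assignment 0̂ and at the unit assignments 𝟙 i.  If they differ for every i, then every variable
-- is a leaf, so there are at least N variable leaves; if moreover the value at 0̂ is 1, there is
-- a leaf 1; and an expression has cost + 1 leaves.  Hence every expression that is 1 at 0̂ and 0
-- at each 𝟙 i costs at least N.  An expression that is 0 at 0̂ and 1 at each 𝟙 i is, for N ≥ 2,
-- of the form f < g: either f is 1 at 0̂ and then 0 at each 𝟙 i, or g satisfies the same
-- conditions as f < g.  By induction its cost is at least N + 1.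
module Submission where

open import Defs
open import Data.Nat using (ℕ; suc; _+_; _≤_; z≤n; s≤s; s≤s⁻¹)
open import Data.Nat.Properties using (≤-trans; m≤m+n; m≤n+m; m≤n⇒m≤1+n; +-suc; +-identityʳ; +-mono-≤; +-commutativeSemigroup; module ≤-Reasoning)
open import Algebra.Properties.CommutativeSemigroup +-commutativeSemigroup using () renaming (interchange to +-interchange)
open import Data.Bool using (Bool; true; false; _∨_; not)
open import Data.Bool.Properties using (not-involutive; ∨-zeroʳ)
open import Data.Fin using (Fin)
open import Data.Fin.Properties using (_≟_; injective⇒≤)
open import Data.List using (List; []; _∷_; _++_; length; allFin; foldr)
open import Data.List.Properties using (length-++; length-tabulate)
import Data.List.Relation.Unary.All as All
open import Data.List.Relation.Unary.AllPairs using (_∷_)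
open import Data.List.Relation.Unary.Any using (here; there)
open import Data.List.Relation.Unary.Unique.Propositional using (Unique)
open import Data.List.Relation.Unary.Unique.Propositional.Properties using (allFin⁺; Unique[x∷xs]⇒x∉xs)
open import Data.List.Membership.Propositional using (_∈_; _∉_)
open import Data.List.Membership.Propositional.Properties using (∈-++⁺ˡ; ∈-++⁺ʳ; ∈-allFin)
open import Data.List.Membership.Setoid.Properties using (index-injective)
import Data.List.Membership.DecPropositional as DecMembership
open import Data.Product using (_×_; _,_; proj₁; proj₂)
open import Function using (id; const)
open import Relation.Nullary using (yes; no; contradiction)
open import Relation.Nullary.Decidable using (does; dec-true; dec-false)
open import Relation.Binary.PropositionalEquality

private
  variable
    n : ℕ

<ᵇ≡true⇒ : ∀ {a b} → a <ᵇ b ≡ true → a ≡ false × b ≡ true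
<ᵇ≡true⇒ {false} {true} refl = refl , refl

false<ᵇ-identity : ∀ b → false <ᵇ b ≡ b
false<ᵇ-identity false = refl
false<ᵇ-identity true  = refl

<ᵇtrue≡not : ∀ b → b <ᵇ true ≡ not b
<ᵇtrue≡not false = refl
<ᵇtrue≡not true  = refl

vars : Expr n → List (Fin n)
vars (var i)   = i ∷ []
vars one       = []
vars (e ⟨<⟩ f) = vars e ++ vars f

ones+length-vars≡1+cost : (e : Expr n) → ones e + length (vars e) ≡ suc (cost e)
ones+length-vars≡1+cost (var i)   = refl
ones+length-vars≡1+cost one       = refl
ones+length-vars≡1+cost (e ⟨<⟩ f) = begin
  (ones e + ones f) + length (vars e ++ vars f)
    ≡⟨ cong ((ones e + ones f) +_) (length-++ (vars e)) ⟩
  (ones e + ones f) + (length (vars e) + length (vars f))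
    ≡⟨ +-interchange (ones e) _ _ _ ⟩
  (ones e + length (vars e)) + (ones f + length (vars f))
    ≡⟨ cong₂ _+_ (ones+length-vars≡1+cost e) (ones+length-vars≡1+cost f) ⟩
  suc (cost e) + suc (cost f)
    ≡⟨ cong suc (+-suc (cost e) (cost f)) ⟩
  suc (suc (cost e + cost f))
    ∎
  where open ≡-Reasoning

eval-cong : (e : Expr n) {ρ σ : Fin n → Bool} →
            (∀ {i} → i ∈ vars e → ρ i ≡ σ i) → eval e ρ ≡ eval e σ
eval-cong (var i)   ρ≡σ = ρ≡σ (here refl)
eval-cong one       ρ≡σ = refl
eval-cong (e ⟨<⟩ f) ρ≡σ = cong₂ _<ᵇ_ (eval-cong e (λ i∈e → ρ≡σ (∈-++⁺ˡ i∈e)))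
                                      (eval-cong f (λ i∈f → ρ≡σ (∈-++⁺ʳ (vars e) i∈f)))

enumeration⇒≤length : (xs : List (Fin n)) → (∀ i → i ∈ xs) → n ≤ length xs
enumeration⇒≤length {n} xs _∈xs =
  injective⇒≤ (λ {i} {j} → index-injective (setoid (Fin n)) (i ∈xs) (j ∈xs))

0̂ : Fin n → Bool
0̂ = const false

𝟙 : Fin n → Fin n → Bool
𝟙 i j = does (j ≟ i)

𝟙-self : (i : Fin n) → 𝟙 i i ≡ true
𝟙-self i = dec-true (i ≟ i) refl

eval-sensitive⇒∈vars : (e : Expr n) (i : Fin n) {ρ σ : Fin n → Bool} →
                       (∀ j → j ≢ i → ρ j ≡ σ j) → eval e ρ ≢ eval e σ → i ∈ vars e
eval-sensitive⇒∈vars e i ρ≡σ-off-i sensitive with DecMembership._∈?_ _≟_ i (vars e)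
... | yes i∈e = i∈e
... | no  i∉e = contradiction (eval-cong e λ {j} j∈e → ρ≡σ-off-i j λ { refl → i∉e j∈e }) sensitive

eval-0̂≡true⇒1≤ones : (e : Expr n) → eval e 0̂ ≡ true → 1 ≤ ones e
eval-0̂≡true⇒1≤ones one       _          = s≤s z≤n
eval-0̂≡true⇒1≤ones (e ⟨<⟩ f) e<f≡true =
  ≤-trans (eval-0̂≡true⇒1≤ones f (proj₂ (<ᵇ≡true⇒ e<f≡true))) (m≤n+m (ones f) (ones e))

nor-lower-bound : (e : Expr n) → eval e 0̂ ≡ true → (∀ i → eval e (𝟙 i) ≡ false) → n ≤ cost e
nor-lower-bound {n} e at0̂ at𝟙 = s≤s⁻¹ (begin
  1 + n                    ≤⟨ +-mono-≤ (eval-0̂≡true⇒1≤ones e at0̂) (enumeration⇒≤length (vars e) every-var) ⟩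
  ones e + length (vars e) ≡⟨ ones+length-vars≡1+cost e ⟩
  suc (cost e)             ∎)
  where
  open ≤-Reasoning
  every-var : ∀ i → i ∈ vars e
  every-var i = eval-sensitive⇒∈vars e i (λ j j≢i → sym (dec-false (j ≟ i) j≢i))
                 λ eq → contradiction (trans (sym at0̂) (trans eq (at𝟙 i))) λ ()

or-lower-bound : ∀ m (e : Expr (suc (suc m))) →
                 eval e 0̂ ≡ false → (∀ i → eval e (𝟙 i) ≡ true) → suc (suc (suc m)) ≤ cost e
or-lower-bound m (var Fin.zero)    _   at𝟙 = contradiction (at𝟙 (Fin.suc Fin.zero)) λ ()
or-lower-bound m (var (Fin.suc i)) _   at𝟙 = contradiction (at𝟙 Fin.zero) λ ()
or-lower-bound m one               ()
or-lower-bound m (f ⟨<⟩ g) at0̂ at𝟙 with eval f 0̂ in f-at0̂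
... | true  = s≤s (≤-trans (nor-lower-bound f f-at0̂ (λ i → proj₁ (<ᵇ≡true⇒ (at𝟙 i)))) (m≤m+n _ _))
... | false = m≤n⇒m≤1+n (≤-trans (or-lower-bound m g g-at0̂ (λ i → proj₂ (<ᵇ≡true⇒ (at𝟙 i))))
                                  (m≤n+m (cost g) (cost f)))
  where
  g-at0̂ : eval g 0̂ ≡ false
  g-at0̂ = trans (sym (false<ᵇ-identity (eval g 0̂))) at0̂

-- disj ρ is anyTrue ρ (allFin n) definitionally.
anyTrue : (Fin n → Bool) → List (Fin n) → Bool
anyTrue ρ = foldr (λ i b → ρ i ∨ b) false

anyTrue-0̂ : (xs : List (Fin n)) → anyTrue 0̂ xs ≡ false
anyTrue-0̂ []       = refl
anyTrue-0̂ (_ ∷ xs) = anyTrue-0̂ xs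

anyTrue-∈ : ∀ {ρ : Fin n → Bool} {i xs} → i ∈ xs → ρ i ≡ true → anyTrue ρ xs ≡ true
anyTrue-∈ (here refl) ρi≡true rewrite ρi≡true = refl
anyTrue-∈ {ρ = ρ} {xs = x ∷ _} (there i∈xs) ρi≡true =
  trans (cong (ρ x ∨_) (anyTrue-∈ i∈xs ρi≡true)) (∨-zeroʳ (ρ x))

disj-lower-bound : ∀ m (e : Expr (suc (suc m))) → Computes e disj → suc (suc (suc m)) ≤ cost e
disj-lower-bound m e computes = or-lower-bound m e
  (trans (computes 0̂) (anyTrue-0̂ (allFin (suc (suc m)))))
  (λ i → trans (computes (𝟙 i)) (anyTrue-∈ {ρ = 𝟙 i} (∈-allFin i) (𝟙-self i)))

<ᵇnot≡nor : ∀ a b → a <ᵇ not b ≡ not (a ∨ b)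
<ᵇnot≡nor false false = refl
<ᵇnot≡nor false true  = refl
<ᵇnot≡nor true  false = refl
<ᵇnot≡nor true  true  = refl

eval-chain : (ρ : Fin n → Bool) (xs : List (Fin n)) → eval (chain xs) ρ ≡ not (anyTrue ρ xs)
eval-chain ρ []       = refl
eval-chain ρ (x ∷ xs) = trans (cong (ρ x <ᵇ_) (eval-chain ρ xs)) (<ᵇnot≡nor (ρ x) (anyTrue ρ xs))

ones-chain : (xs : List (Fin n)) → ones (chain xs) ≡ 1
ones-chain []       = refl
ones-chain (_ ∷ xs) = ones-chain xs

cost-chain : (xs : List (Fin n)) → cost (chain xs) ≡ length xs
cost-chain []       = refl
cost-chain (_ ∷ xs) = cong suc (cost-chain xs)

occ-var-≡ : (i : Fin n) → occ i (var i) ≡ 1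
occ-var-≡ i rewrite dec-true (i ≟ i) refl = refl

occ-var-≢ : {i j : Fin n} → i ≢ j → occ i (var j) ≡ 0
occ-var-≢ {i = i} {j} i≢j rewrite dec-false (i ≟ j) i≢j = refl

occ-chain-∉ : ∀ {i : Fin n} {xs} → i ∉ xs → occ i (chain xs) ≡ 0
occ-chain-∉ {xs = []}     _   = refl
occ-chain-∉ {i = i} {x ∷ xs} i∉ =
  cong₂ _+_ (occ-var-≢ {i = i} {x} λ { refl → i∉ (here refl) })
            (occ-chain-∉ (λ i∈xs → i∉ (there i∈xs)))

occ-chain-∈ : ∀ {i : Fin n} {xs} → Unique xs → i ∈ xs → occ i (chain xs) ≡ 1
occ-chain-∈ {i = i} unique@(_ ∷ _) (here refl) =
  cong₂ _+_ (occ-var-≡ i) (occ-chain-∉ (Unique[x∷xs]⇒x∉xs unique))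
occ-chain-∈ {i = i} {x ∷ _} (x≢xs ∷ unique) (there i∈xs) =
  cong₂ _+_ (occ-var-≢ {i = i} {x} λ { refl → All.lookup x≢xs i∈xs refl })
            (occ-chain-∈ unique i∈xs)

orRep-computes-disj : Computes (orRep n) disj
orRep-computes-disj {n} ρ = begin
  eval (D₁ n) ρ <ᵇ true     ≡⟨ <ᵇtrue≡not (eval (D₁ n) ρ) ⟩
  not (eval (D₁ n) ρ)       ≡⟨ cong not (eval-chain ρ (allFin n)) ⟩
  not (not (disj ρ))        ≡⟨ not-involutive (disj ρ) ⟩
  disj ρ                    ∎
  where open ≡-Reasoning

ones-orRep : ones (orRep n) ≡ 2
ones-orRep {n} = cong (_+ 1) (ones-chain (allFin n))

occ-orRep : (i : Fin n) → occ i (orRep n) ≡ 1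
occ-orRep {n} i = trans (+-identityʳ _) (occ-chain-∈ (allFin⁺ n) (∈-allFin i))

cost-orRep : cost (orRep n) ≡ suc n
cost-orRep {n} = cong suc (trans (+-identityʳ _) (trans (cost-chain (allFin n)) (length-tabulate id)))

proposition4 : (N : ℕ) → 2 ≤ N →
    Computes (orRep N) disj
    × ones (orRep N) ≡ 2
    × (∀ (i : Fin N) → occ i (orRep N) ≡ 1)
    × (∀ (e : Expr N) → Computes e disj → cost (orRep N) ≤ cost e)
proposition4 (suc (suc m)) (s≤s (s≤s z≤n)) =
  orRep-computes-disj , ones-orRep {suc (suc m)} , occ-orRep ,
  λ e computes → subst (_≤ cost e) (sym cost-orRep) (disj-lower-bound m e computes)
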